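{- Let $n\ge k\ge 2$ be integers with $k\equiv 2$ or $3\pmod 4$ and $\binom{n}{k}$ odd. Then the map $\sigma:\mathcal{E}^\circ\to\mathcal{E}^\circ$, $\sigma(M) := \mathrm{I}(n,k) - M$ (entrywise subtraction), is well defined, is an involution ($\sigma(\sigma(M))=M$), and is sign-reversing ($(-1)^{|\sigma(M)|} = -(-1)^{|M|}$ for all $M\in\mathcal{E}^\circ$).
   Context: $[n]=\{1,\dots,n\}$; $\binom{[n]}{j}$ is the set of $j$-element subsets of $[n]$. The incidence matrix $\mathrm{I}(n,k)\in\{0,1\}^{\binom{[n]}{2}\times\binom{[n]}{k}}$ has rows indexed by $\binom{[n]}{2}$, columns indexed by $\binom{[n]}{k}$, and $(e,S)$-entry $1$ iff $e\subseteq S$. For $\{0,1\}$-matrices $A,B$ of the same shape, $A\preceq B$ means $A_{ij}\le B_{ij}$ for all $i,j$. Let $\mathcal{A}'$ be the set of $M\in\{0,1\}^{\binom{[n]}{2}\times\binom{[n]}{k}}$ with $M\preceq\mathrm{I}(n,k)$ and every column of $M$ having at least $1$ and at most $\binom{k}{2}-1$ ones. For such $M$, $|M|$ is the sum of all entries, and $\mathrm{Edges}(M)$ is the set of rows $e$ containing at least one $1$. Let $\mathcal{E}_{\binom{n}{2}}$ be the set of $M\in\mathcal{A}'$ with $|\mathrm{Edges}(M)|=\binom{n}{2}$, and let $\mathcal{E}^\circ\subseteq\mathcal{E}_{\binom{n}{2}}$ be the set of those $M$ in which every row has at least $1$ and at most $\binom{n-2}{k-2}-1$ ones. -}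

module Defs where

open import Data.Bool.Base using (Bool; true; false)
open import Data.Nat.Base using (ℕ; zero; suc; _+_; _∸_; _≤_; _<_)
open import Data.Nat.Properties using (_≟_)
open import Data.Nat.Combinatorics using (_C_)
open import Data.List.Base using (List; []; _∷_; _++_; map; length; filter)
open import Data.Nat.ListAction using (sum)
open import Data.Vec.Base using ([]; _∷_)
open import Data.Maybe.Base using (Maybe; just; nothing)
open import Data.List.Base using (mapMaybe)
open import Data.Fin.Subset using (Subset; ∣_∣; _⊆_)
open import Data.Fin.Subset.Properties using (_⊆?_)
open import Data.Product using (Σ; _,_; proj₁; _×_)
open import Relation.Nullary using (yes; no)
open import Relation.Binary.PropositionalEquality using (_≡_)
open import Relation.Nullary.Decidable using (does)
open import Data.Nat.Properties using (_<?_)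

allSubsets : (n : ℕ) → List (Subset n)
allSubsets zero    = [] ∷ []
allSubsets (suc n) = map (true ∷_) (allSubsets n) ++ map (false ∷_) (allSubsets n)

Choose : (n j : ℕ) → Set
Choose n j = Σ (Subset n) (λ S → ∣ S ∣ ≡ j)

withSize : {n : ℕ} (j : ℕ) → Subset n → Maybe (Choose n j)
withSize j S with ∣ S ∣ ≟ j
... | yes p = just (S , p)
... | no _  = nothing

choose : (n j : ℕ) → List (Choose n j)
choose n j = mapMaybe (withSize j) (allSubsets n)

-- matrices with rows indexed by binom([n],2) and columns by binom([n],k)
-- (entries in ℕ; {0,1}-valuedness is imposed as a condition)
Matrix : (n k : ℕ) → Set
Matrix n k = Choose n 2 → Choose n k → ℕ

I : (n k : ℕ) → Matrix n k
I n k e S with proj₁ e ⊆? proj₁ S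
... | yes _ = 1
... | no _  = 0

_⪯_ : {n k : ℕ} → Matrix n k → Matrix n k → Set
A ⪯ B = ∀ e S → A e S ≤ B e S

IsZeroOne : {n k : ℕ} → Matrix n k → Set
IsZeroOne M = ∀ e S → M e S ≤ 1

colSum : {n k : ℕ} → Matrix n k → Choose n k → ℕ
colSum {n} M S = sum (map (λ e → M e S) (choose n 2))

rowSum : {n k : ℕ} → Matrix n k → Choose n 2 → ℕ
rowSum {n} {k} M e = sum (map (λ S → M e S) (choose n k))

total : {n k : ℕ} → Matrix n k → ℕ
total {n} {k} M = sum (map (colSum M) (choose n k))

Edges : {n k : ℕ} → Matrix n k → List (Choose n 2)
Edges {n} M = filter (λ e → 0 <? rowSum M e) (choose n 2)

In𝒜' : (n k : ℕ) → Matrix n k → Set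
In𝒜' n k M = IsZeroOne M × (M ⪯ I n k)
  × (∀ S → 1 ≤ colSum M S × colSum M S ≤ (k C 2) ∸ 1)

In𝓔full : (n k : ℕ) → Matrix n k → Set
In𝓔full n k M = In𝒜' n k M × length (Edges M) ≡ n C 2

In𝓔° : (n k : ℕ) → Matrix n k → Set
In𝓔° n k M = In𝓔full n k M
  × (∀ e → 1 ≤ rowSum M e × rowSum M e ≤ ((n ∸ 2) C (k ∸ 2)) ∸ 1)

-- σ(M) = I(n,k) − M  (entrywise; truncated subtraction, which is genuine
-- subtraction whenever M ⪯ I(n,k))
σ : {n k : ℕ} → Matrix n k → Matrix n k
σ {n} {k} M e S = I n k e S ∸ M e S

{-# OPTIONS --safe #-}
-- Every column of I(n,k) has C(k,2) ones and every row C(n−2,k−2) ones, so for M ⪯ I(n,k) the column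
-- and row sums of σ(M) are C(k,2) − c and C(n−2,k−2) − r, and the bounds 1 ≤ x ≤ K − 1 defining E°
-- are symmetric under x ↦ K − x.  Summing all entries, |σ(M)| + |M| = |I(n,k)| = C(n,k)·C(k,2), which
-- is odd because C(k,2) is odd for k ≡ 2, 3 (mod 4); so |σ(M)| and |M| have opposite parities.

module Submission where

open import Defs
open import Data.Nat.Base using (ℕ; _≤_; _%_)
open import Data.Nat.Combinatorics using (_C_)
open import Data.Integer.Base using (ℤ; -_; _^_; -1ℤ)
open import Data.Sum using (_⊎_)
open import Data.Product using (_×_)
open import Relation.Binary.PropositionalEquality using (_≡_)

open import Algebra.Properties.CommutativeSemigroup using (interchange)
open import Data.Bool.Base using (Bool; true; false; _∧_)
open import Data.Bool.Properties using (∧-zeroʳ; ∧-identityʳ)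
open import Data.Fin.Subset using (Subset; ∣_∣; ⊤)
open import Data.Fin.Subset.Properties using (_⊆?_; ⊆⊤; ∣⊤∣≡n; ∣p∣≤n; p⊆q⇒∣p∣≤∣q∣)
import Data.Integer.Base as ℤ
import Data.Integer.Properties as ℤ
open import Data.List.Base using (List; []; _∷_; _++_; map; length; mapMaybe)
open import Data.List.Properties using (map-++; map-∘; map-cong; filter-all)
open import Data.List.Relation.Unary.All using (universal)
open import Data.Maybe.Base using (Maybe; just; nothing; maybe′)
open import Data.Nat.Base using (zero; suc; _+_; _*_; _∸_; _/_; z≤n; s≤s)
open import Data.Nat.Combinatorics using (nCk+nC[k+1]≡[n+1]C[k+1]; nC1≡n)
open import Data.Nat.DivMod using (m≡m%n+[m/n]*n; [m+kn]%n≡m%n; %-distribˡ-*)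
open import Data.Nat.ListAction using (sum)
open import Data.Nat.ListAction.Properties using (sum-++)
open import Data.Nat.Properties
  using (_≟_; _<?_; +-suc; +-identityʳ; *-comm; *-zeroʳ; *-identityʳ; +-∸-assoc;
         ≤-reflexive; m∸n≤m; m∸n+n≡m; m∸[m∸n]≡n; m<m+n; ≤-trans; 1+n≰n;
         +-commutativeSemigroup)
open import Data.Nat.Solver using (module +-*-Solver)
open import Data.Product using (_,_; proj₁)
open import Data.Sum using (inj₁; inj₂)
open import Data.Vec.Base using ([]; _∷_)
open import Function.Base using (_∘_; const)
open import Relation.Binary.PropositionalEquality
  using (refl; sym; trans; cong; cong₂; module ≡-Reasoning)
open import Relation.Nullary using (yes; no; does; contradiction)
open import Relation.Nullary.Decidable using (dec-true; dec-false)

open ≡-Reasoning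

sum-map-+ : {A : Set} (f g : A → ℕ) (xs : List A) →
            sum (map (λ x → f x + g x) xs) ≡ sum (map f xs) + sum (map g xs)
sum-map-+ f g []       = refl
sum-map-+ f g (x ∷ xs) = begin
  (f x + g x) + sum (map (λ x → f x + g x) xs)          ≡⟨ cong (f x + g x +_) (sum-map-+ f g xs) ⟩
  (f x + g x) + (sum (map f xs) + sum (map g xs))       ≡⟨ interchange +-commutativeSemigroup (f x) (g x) _ _ ⟩
  (f x + sum (map f xs)) + (g x + sum (map g xs))       ∎

sum-map-const : {A : Set} (c : ℕ) (xs : List A) → sum (map (const c) xs) ≡ length xs * c
sum-map-const c []       = refl
sum-map-const c (x ∷ xs) = cong (c +_) (sum-map-const c xs)

sum-map-mapMaybe : {A B : Set} (g : B → ℕ) (f : A → Maybe B) (xs : List A) →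
                   sum (map g (mapMaybe f xs)) ≡ sum (map (maybe′ g 0 ∘ f) xs)
sum-map-mapMaybe g f []       = refl
sum-map-mapMaybe g f (x ∷ xs) with f x
... | just y  = cong (g y +_) (sum-map-mapMaybe g f xs)
... | nothing = sum-map-mapMaybe g f xs

𝟙 : Bool → ℕ
𝟙 true  = 1
𝟙 false = 0

#subsets : (n : ℕ) → (Subset n → Bool) → ℕ
#subsets n p = sum (map (𝟙 ∘ p) (allSubsets n))

#subsets-cong : (n : ℕ) {p q : Subset n → Bool} → (∀ S → p S ≡ q S) → #subsets n p ≡ #subsets n q
#subsets-cong n p≗q = cong sum (map-cong (cong 𝟙 ∘ p≗q) (allSubsets n))

#subsets-none : (n : ℕ) {p : Subset n → Bool} → (∀ S → p S ≡ false) → #subsets n p ≡ 0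
#subsets-none n {p} p≗false = begin
  #subsets n p                  ≡⟨ #subsets-cong n p≗false ⟩
  #subsets n (const false)      ≡⟨ sum-map-const 0 (allSubsets n) ⟩
  length (allSubsets n) * 0     ≡⟨ *-zeroʳ (length (allSubsets n)) ⟩
  0                             ∎

#subsets-suc : (n : ℕ) (p : Subset (suc n) → Bool) →
               #subsets (suc n) p ≡ #subsets n (p ∘ (true ∷_)) + #subsets n (p ∘ (false ∷_))
#subsets-suc n p = begin
  sum (map (𝟙 ∘ p) (map (true ∷_) Ss ++ map (false ∷_) Ss))
    ≡⟨ cong sum (map-++ (𝟙 ∘ p) (map (true ∷_) Ss) _) ⟩
  sum (map (𝟙 ∘ p) (map (true ∷_) Ss) ++ map (𝟙 ∘ p) (map (false ∷_) Ss))
    ≡⟨ sum-++ (map (𝟙 ∘ p) (map (true ∷_) Ss)) _ ⟩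
  sum (map (𝟙 ∘ p) (map (true ∷_) Ss)) + sum (map (𝟙 ∘ p) (map (false ∷_) Ss))
    ≡⟨ sym (cong₂ _+_ (cong sum (map-∘ Ss)) (cong sum (map-∘ Ss))) ⟩
  #subsets n (p ∘ (true ∷_)) + #subsets n (p ∘ (false ∷_))
    ∎
  where
  Ss : List (Subset n)
  Ss = allSubsets n

#subsets-of-size : (n : ℕ) (S : Subset n) (j : ℕ) →
                   #subsets n (λ E → does (∣ E ∣ ≟ j) ∧ does (E ⊆? S)) ≡ ∣ S ∣ C j
#subsets-of-size zero    []          zero    = refl
#subsets-of-size zero    []          (suc j) = refl
#subsets-of-size (suc n) (true ∷ S)  zero    =
  trans (#subsets-suc n _) (cong₂ _+_ (#subsets-none n (λ _ → refl)) (#subsets-of-size n S zero))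
#subsets-of-size (suc n) (true ∷ S)  (suc j) = begin
  _                             ≡⟨ #subsets-suc n _ ⟩
  _                             ≡⟨ cong₂ _+_ (#subsets-of-size n S j) (#subsets-of-size n S (suc j)) ⟩
  ∣ S ∣ C j + ∣ S ∣ C suc j     ≡⟨ nCk+nC[k+1]≡[n+1]C[k+1] ∣ S ∣ j ⟩
  suc ∣ S ∣ C suc j             ∎
#subsets-of-size (suc n) (false ∷ S) j       =
  trans (#subsets-suc n _)
        (cong₂ _+_ (#subsets-none n (λ E → ∧-zeroʳ (does (suc ∣ E ∣ ≟ j)))) (#subsets-of-size n S j))

#supersets-of-size : (n : ℕ) (T : Subset n) (j : ℕ) →
                     #subsets n (λ S → does (∣ S ∣ ≟ j + ∣ T ∣) ∧ does (T ⊆? S)) ≡ (n ∸ ∣ T ∣) C j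
#supersets-of-size zero    []          zero    = refl
#supersets-of-size zero    []          (suc j) = refl
#supersets-of-size (suc n) (true ∷ T)  j       =
  trans (#subsets-suc n _)
        (trans (cong₂ _+_ (trans (#subsets-cong n shift) (#supersets-of-size n T j))
                          (#subsets-none n (λ S → ∧-zeroʳ (does (∣ S ∣ ≟ j + suc ∣ T ∣)))))
               (+-identityʳ _))
  where
  shift : ∀ S → (does (suc ∣ S ∣ ≟ j + suc ∣ T ∣) ∧ does (T ⊆? S))
              ≡ (does (∣ S ∣ ≟ j + ∣ T ∣) ∧ does (T ⊆? S))
  shift S = cong (λ m → does (suc ∣ S ∣ ≟ m) ∧ does (T ⊆? S)) (+-suc j ∣ T ∣)
#supersets-of-size (suc n) (false ∷ T) zero    =
  trans (#subsets-suc n _) (cong₂ _+_ (#subsets-none n too-large) (#supersets-of-size n T zero))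
  where
  too-large : ∀ S → does (suc ∣ S ∣ ≟ ∣ T ∣) ∧ does (T ⊆? S) ≡ false
  too-large S with T ⊆? S
  ... | no  _   = ∧-zeroʳ (does (suc ∣ S ∣ ≟ ∣ T ∣))
  ... | yes T⊆S = trans (∧-identityʳ _)
                        (dec-false (suc ∣ S ∣ ≟ ∣ T ∣) λ eq →
                           1+n≰n (≤-trans (≤-reflexive eq) (p⊆q⇒∣p∣≤∣q∣ T⊆S)))
#supersets-of-size (suc n) (false ∷ T) (suc j) = begin
  _                                        ≡⟨ #subsets-suc n _ ⟩
  _                                        ≡⟨ cong₂ _+_ (#supersets-of-size n T j) (#supersets-of-size n T (suc j)) ⟩
  (n ∸ ∣ T ∣) C j + (n ∸ ∣ T ∣) C suc j    ≡⟨ nCk+nC[k+1]≡[n+1]C[k+1] (n ∸ ∣ T ∣) j ⟩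
  suc (n ∸ ∣ T ∣) C suc j                  ≡⟨ cong (_C suc j) (sym (+-∸-assoc 1 (∣p∣≤n T))) ⟩
  (suc n ∸ ∣ T ∣) C suc j                  ∎

sum-map-choose : (n j : ℕ) (g : Choose n j → ℕ) (p : Subset n → Bool) →
                 (∀ c → g c ≡ 𝟙 (p (proj₁ c))) →
                 sum (map g (choose n j)) ≡ #subsets n (λ S → does (∣ S ∣ ≟ j) ∧ p S)
sum-map-choose n j g p g≗p =
  trans (sum-map-mapMaybe g (withSize j) (allSubsets n)) (cong sum (map-cong restrict (allSubsets n)))
  where
  restrict : ∀ S → maybe′ g 0 (withSize j S) ≡ 𝟙 (does (∣ S ∣ ≟ j) ∧ p S)
  restrict S with ∣ S ∣ ≟ j
  ... | yes ∣S∣≡j = trans (g≗p (S , ∣S∣≡j))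
                          (cong (λ b → 𝟙 (b ∧ p S)) (sym (dec-true (∣ S ∣ ≟ j) ∣S∣≡j)))
  ... | no  ∣S∣≢j = cong (λ b → 𝟙 (b ∧ p S)) (sym (dec-false (∣ S ∣ ≟ j) ∣S∣≢j))

I≡𝟙[⊆] : (n k : ℕ) (e : Choose n 2) (S : Choose n k) → I n k e S ≡ 𝟙 (does (proj₁ e ⊆? proj₁ S))
I≡𝟙[⊆] n k e S with proj₁ e ⊆? proj₁ S
... | yes _ = refl
... | no  _ = refl

length-choose : (n j : ℕ) → length (choose n j) ≡ n C j
length-choose n j = begin
  length (choose n j)                                     ≡⟨ sym (*-identityʳ _) ⟩
  length (choose n j) * 1                                 ≡⟨ sym (sum-map-const 1 (choose n j)) ⟩
  sum (map (const 1) (choose n j))                        ≡⟨ sum-map-choose n j (const 1) (does ∘ (_⊆? ⊤)) ⊆⊤-is-1 ⟩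
  #subsets n (λ E → does (∣ E ∣ ≟ j) ∧ does (E ⊆? ⊤))     ≡⟨ #subsets-of-size n ⊤ j ⟩
  ∣ ⊤ {n} ∣ C j                                           ≡⟨ cong (_C j) (∣⊤∣≡n n) ⟩
  n C j                                                   ∎
  where
  ⊆⊤-is-1 : (E : Choose n j) → 1 ≡ 𝟙 (does (proj₁ E ⊆? ⊤))
  ⊆⊤-is-1 E = sym (cong 𝟙 (dec-true (proj₁ E ⊆? ⊤) ⊆⊤))

colSum-I : (n k : ℕ) (S : Choose n k) → colSum (I n k) S ≡ k C 2
colSum-I n k (S , ∣S∣≡k) = begin
  colSum (I n k) (S , ∣S∣≡k)
    ≡⟨ sum-map-choose n 2 _ (does ∘ (_⊆? S)) (λ e → I≡𝟙[⊆] n k e (S , ∣S∣≡k)) ⟩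
  #subsets n (λ E → does (∣ E ∣ ≟ 2) ∧ does (E ⊆? S))
    ≡⟨ #subsets-of-size n S 2 ⟩
  ∣ S ∣ C 2
    ≡⟨ cong (_C 2) ∣S∣≡k ⟩
  k C 2
    ∎

rowSum-I : (n k : ℕ) → 2 ≤ k → (e : Choose n 2) → rowSum (I n k) e ≡ (n ∸ 2) C (k ∸ 2)
rowSum-I n k 2≤k (T , ∣T∣≡2) = begin
  rowSum (I n k) (T , ∣T∣≡2)
    ≡⟨ sum-map-choose n k _ (does ∘ (T ⊆?_)) (I≡𝟙[⊆] n k (T , ∣T∣≡2)) ⟩
  #subsets n (λ S → does (∣ S ∣ ≟ k) ∧ does (T ⊆? S))
    ≡⟨ #subsets-cong n (λ S → cong (λ m → does (∣ S ∣ ≟ m) ∧ does (T ⊆? S)) k≡[k∸2]+∣T∣) ⟩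
  #subsets n (λ S → does (∣ S ∣ ≟ (k ∸ 2) + ∣ T ∣) ∧ does (T ⊆? S))
    ≡⟨ #supersets-of-size n T (k ∸ 2) ⟩
  (n ∸ ∣ T ∣) C (k ∸ 2)
    ≡⟨ cong (λ t → (n ∸ t) C (k ∸ 2)) ∣T∣≡2 ⟩
  (n ∸ 2) C (k ∸ 2)
    ∎
  where
  k≡[k∸2]+∣T∣ : k ≡ (k ∸ 2) + ∣ T ∣
  k≡[k∸2]+∣T∣ = trans (sym (m∸n+n≡m 2≤k)) (cong ((k ∸ 2) +_) (sym ∣T∣≡2))

total-I : (n k : ℕ) → total (I n k) ≡ (n C k) * (k C 2)
total-I n k = begin
  sum (map (colSum (I n k)) (choose n k))   ≡⟨ cong sum (map-cong (colSum-I n k) (choose n k)) ⟩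
  sum (map (const (k C 2)) (choose n k))    ≡⟨ sum-map-const (k C 2) (choose n k) ⟩
  length (choose n k) * (k C 2)             ≡⟨ cong (_* (k C 2)) (length-choose n k) ⟩
  (n C k) * (k C 2)                         ∎

module _ {n k : ℕ} {M : Matrix n k} (M⪯I : M ⪯ I n k) where

  σ+M≡I : ∀ e S → σ M e S + M e S ≡ I n k e S
  σ+M≡I e S = m∸n+n≡m (M⪯I e S)

  σ-involutive : ∀ e S → σ (σ M) e S ≡ M e S
  σ-involutive e S = m∸[m∸n]≡n (M⪯I e S)

  colSum-σ : ∀ S → colSum (σ M) S + colSum M S ≡ colSum (I n k) S
  colSum-σ S = trans (sym (sum-map-+ (λ e → σ M e S) (λ e → M e S) (choose n 2)))
                     (cong sum (map-cong (λ e → σ+M≡I e S) (choose n 2)))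

  rowSum-σ : ∀ e → rowSum (σ M) e + rowSum M e ≡ rowSum (I n k) e
  rowSum-σ e = trans (sym (sum-map-+ (σ M e) (M e) (choose n k)))
                     (cong sum (map-cong (σ+M≡I e) (choose n k)))

  total-σ : total (σ M) + total M ≡ total (I n k)
  total-σ = trans (sym (sum-map-+ (colSum (σ M)) (colSum M) (choose n k)))
                  (cong sum (map-cong colSum-σ (choose n k)))

σ-IsZeroOne : {n k : ℕ} (M : Matrix n k) → IsZeroOne (σ M)
σ-IsZeroOne {n} {k} M e S = ≤-trans (m∸n≤m (I n k e S) (M e S)) (I≤1 e S)
  where
  I≤1 : ∀ e S → I n k e S ≤ 1
  I≤1 e S with proj₁ e ⊆? proj₁ S
  ... | yes _ = s≤s z≤n
  ... | no  _ = z≤n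

σ⪯I : {n k : ℕ} (M : Matrix n k) → σ M ⪯ I n k
σ⪯I {n} {k} M e S = m∸n≤m (I n k e S) (M e S)

complement-between : ∀ c m K → c + m ≡ K → 1 ≤ m × m ≤ K ∸ 1 → 1 ≤ c × c ≤ K ∸ 1
complement-between zero    (suc m) _ refl (_ , m≤m-1) = contradiction m≤m-1 1+n≰n
complement-between (suc c) (suc m) _ refl _           = s≤s z≤n , m<m+n c (s≤s z≤n)

σ-In𝓔° : (n k : ℕ) → 2 ≤ k → (M : Matrix n k) → In𝓔° n k M → In𝓔° n k (σ M)
σ-In𝓔° n k 2≤k M (((_ , M⪯I , colBounds) , _) , rowBounds) =
  ((σ-IsZeroOne M , σ⪯I M , colBounds′) , edges′) , rowBounds′
  where
  colBounds′ : ∀ S → 1 ≤ colSum (σ M) S × colSum (σ M) S ≤ (k C 2) ∸ 1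
  colBounds′ S = complement-between _ _ _ (trans (colSum-σ M⪯I S) (colSum-I n k S)) (colBounds S)
  rowBounds′ : ∀ e → 1 ≤ rowSum (σ M) e × rowSum (σ M) e ≤ ((n ∸ 2) C (k ∸ 2)) ∸ 1
  rowBounds′ e = complement-between _ _ _ (trans (rowSum-σ M⪯I e) (rowSum-I n k 2≤k e)) (rowBounds e)
  edges′ : length (Edges (σ M)) ≡ n C 2
  edges′ = trans (cong length (filter-all (λ e → 0 <? rowSum (σ M) e)
                                          (universal (proj₁ ∘ rowBounds′) (choose n 2))))
                 (length-choose n 2)

[1+m]C2≡m+mC2 : ∀ m → suc m C 2 ≡ m + m C 2
[1+m]C2≡m+mC2 m = trans (sym (nCk+nC[k+1]≡[n+1]C[k+1] m 1)) (cong (_+ m C 2) (nC1≡n m))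

[4+m]C2≡mC2+[3+m*2]*2 : ∀ m → (4 + m) C 2 ≡ m C 2 + (3 + m * 2) * 2
[4+m]C2≡mC2+[3+m*2]*2 m = begin
  (4 + m) C 2
    ≡⟨ [1+m]C2≡m+mC2 (3 + m) ⟩
  (3 + m) + (3 + m) C 2
    ≡⟨ cong ((3 + m) +_) ([1+m]C2≡m+mC2 (2 + m)) ⟩
  (3 + m) + ((2 + m) + (2 + m) C 2)
    ≡⟨ cong (λ t → (3 + m) + ((2 + m) + t)) ([1+m]C2≡m+mC2 (1 + m)) ⟩
  (3 + m) + ((2 + m) + ((1 + m) + (1 + m) C 2))
    ≡⟨ cong (λ t → (3 + m) + ((2 + m) + ((1 + m) + t))) ([1+m]C2≡m+mC2 m) ⟩
  (3 + m) + ((2 + m) + ((1 + m) + (m + m C 2)))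
    ≡⟨ solve 2 (λ m c → (con 3 :+ m) :+ ((con 2 :+ m) :+ ((con 1 :+ m) :+ (m :+ c)))
                        := c :+ (con 3 :+ m :* con 2) :* con 2) refl m (m C 2) ⟩
  m C 2 + (3 + m * 2) * 2
    ∎
  where open +-*-Solver

-- (4 + m) % 4 and m % 4 are definitionally equal, so the hypothesis is passed on unchanged.
C2-odd : ∀ k → k % 4 ≡ 2 ⊎ k % 4 ≡ 3 → (k C 2) % 2 ≡ 1
C2-odd 0 (inj₁ ())
C2-odd 0 (inj₂ ())
C2-odd 1 (inj₁ ())
C2-odd 1 (inj₂ ())
C2-odd 2 _ = refl
C2-odd 3 _ = refl
C2-odd (suc (suc (suc (suc m)))) k%4 = begin
  ((4 + m) C 2) % 2                  ≡⟨ cong (_% 2) ([4+m]C2≡mC2+[3+m*2]*2 m) ⟩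
  (m C 2 + (3 + m * 2) * 2) % 2      ≡⟨ [m+kn]%n≡m%n (m C 2) (3 + m * 2) 2 ⟩
  (m C 2) % 2                        ≡⟨ C2-odd m k%4 ⟩
  1                                  ∎

*-odd : ∀ a b → a % 2 ≡ 1 → b % 2 ≡ 1 → (a * b) % 2 ≡ 1
*-odd a b a%2≡1 b%2≡1 =
  trans (%-distribˡ-* a b 2) (cong₂ (λ x y → (x * y) % 2) a%2≡1 b%2≡1)

-1ℤ^[2*m]≡1 : ∀ m → -1ℤ ^ (2 * m) ≡ ℤ.1ℤ
-1ℤ^[2*m]≡1 m = trans (sym (ℤ.^-*-assoc -1ℤ 2 m)) (ℤ.^-zeroˡ m)

-1ℤ^odd : ∀ m → m % 2 ≡ 1 → -1ℤ ^ m ≡ -1ℤ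
-1ℤ^odd m m%2≡1 = begin
  -1ℤ ^ m                        ≡⟨ cong (-1ℤ ^_) m≡1+2*[m/2] ⟩
  -1ℤ ℤ.* -1ℤ ^ (2 * (m / 2))    ≡⟨ cong (-1ℤ ℤ.*_) (-1ℤ^[2*m]≡1 (m / 2)) ⟩
  -1ℤ                            ∎
  where
  m≡1+2*[m/2] : m ≡ 1 + 2 * (m / 2)
  m≡1+2*[m/2] = trans (m≡m%n+[m/n]*n m 2) (cong₂ _+_ m%2≡1 (*-comm (m / 2) 2))

-1ℤ^-opposite : ∀ a b → (a + b) % 2 ≡ 1 → -1ℤ ^ a ≡ - (-1ℤ ^ b)
-1ℤ^-opposite a b [a+b]%2≡1 = begin
  -1ℤ ^ a                         ≡⟨ sym (ℤ.*-identityʳ _) ⟩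
  -1ℤ ^ a ℤ.* ℤ.1ℤ                ≡⟨ cong (-1ℤ ^ a ℤ.*_) (sym (-1ℤ^[2*m]≡1 b)) ⟩
  -1ℤ ^ a ℤ.* -1ℤ ^ (2 * b)       ≡⟨ sym (ℤ.^-distribˡ-+-* -1ℤ a (2 * b)) ⟩
  -1ℤ ^ (a + 2 * b)               ≡⟨ cong (-1ℤ ^_) a+2b≡[a+b]+b ⟩
  -1ℤ ^ ((a + b) + b)             ≡⟨ ℤ.^-distribˡ-+-* -1ℤ (a + b) b ⟩
  -1ℤ ^ (a + b) ℤ.* -1ℤ ^ b       ≡⟨ cong (ℤ._* -1ℤ ^ b) (-1ℤ^odd (a + b) [a+b]%2≡1) ⟩
  -1ℤ ℤ.* -1ℤ ^ b                 ≡⟨ ℤ.-1*i≡-i (-1ℤ ^ b) ⟩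
  - (-1ℤ ^ b)                     ∎
  where
  open +-*-Solver
  a+2b≡[a+b]+b : a + 2 * b ≡ (a + b) + b
  a+2b≡[a+b]+b = solve 2 (λ a b → a :+ con 2 :* b := (a :+ b) :+ b) refl a b

proposition5p2 : (n k : ℕ) → 2 ≤ k → k ≤ n
    → (k % 4 ≡ 2 ⊎ k % 4 ≡ 3) → (n C k) % 2 ≡ 1
    → (M : Matrix n k) → In𝓔° n k M
    → In𝓔° n k (σ M)
      × (∀ e S → σ (σ M) e S ≡ M e S)
      × (-1ℤ ^ total (σ M) ≡ - (-1ℤ ^ total M))
proposition5p2 n k 2≤k _ k%4 nCk-odd M M∈𝓔°@(((_ , M⪯I , _) , _) , _) =
  σ-In𝓔° n k 2≤k M M∈𝓔° , σ-involutive M⪯I , -1ℤ^-opposite (total (σ M)) (total M) |σM|+|M|-odd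
  where
  |σM|+|M|-odd : (total (σ M) + total M) % 2 ≡ 1
  |σM|+|M|-odd = begin
    (total (σ M) + total M) % 2    ≡⟨ cong (_% 2) (trans (total-σ M⪯I) (total-I n k)) ⟩
    ((n C k) * (k C 2)) % 2        ≡⟨ *-odd (n C k) (k C 2) nCk-odd (C2-odd k k%4) ⟩
    1                              ∎
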